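{- Let $n\ge1$ and let $\lambda$ be a partition with $1\le|\lambda|\le n+1$. Let $\sigma\in\mathcal{OP}_{n,\lambda}$ satisfy Conditions 1 and 2. Then there exists $\gamma\in\mathcal{OP}_{n,\lambda}$ satisfying Conditions 1, 2 and 3 such that $\mathsf{code}(\gamma)_i\le\mathsf{code}(\sigma)_i$ for all $i\in[n]$.
   Context: For a partition $\lambda$ with conjugate $\lambda'$, consider the Young diagram of $\lambda'$ (row $i$, counted from the top, has boxes in columns $1,\dots,\lambda'_i$; column $c$ has $\lambda_c$ boxes in rows $1,\dots,\lambda_c$), columns indexed by all positive integers. A container diagram of $(n,\lambda)$ is a placement of each of $1,\dots,n$ exactly once, either in a box or floating above row 1 in some column, such that each box has at most one number, numbers strictly decrease from top to bottom in each column (floating numbers being above all boxes), and an empty box has no number above it in its column. Equivalently: an ordered sequence $(S_1,S_2,\dots)$ of disjoint sets with union $[n]$, the elements of $S_c$ placed in column $c$ decreasingly from top to bottom with the smallest in row $\lambda_c$, the next in row $\lambda_c-1$, etc., extras floating above and unfilled top boxes empty. $\mathcal{OP}_{n,\lambda}$ is the set of container diagrams. Treating empty boxes as containing $\infty$, $\mathsf{code}(\sigma)$ is the length-$n$ sequence whose $i$-th entry is: if $i$ is in a box in row $r$, column $c$, the number of boxes in row $r$ in columns $>c$ or in row $r+1$ in columns $<c$ containing a number larger than $i$; if $i$ floats in column $c$, $c-1$ plus the number of boxes in row 1 in columns $>c$ containing a number larger than $i$. Conditions: (1) exactly one box of the Young diagram is empty; (2) the box entries decrease from left to right in each row, and the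 empty box is in row 1, column 1; (3) if a number $i$ floats in column $c$, then every column $c'<c$ contains a box that is empty or contains a number larger than $i$. -}

module Defs where

open import Data.Nat using (ℕ; zero; suc; _+_; _∸_; _≤_; _<_; _≤ᵇ_; _<ᵇ_; _≡ᵇ_)
open import Data.Fin using (Fin; toℕ)
open import Data.Bool using (Bool; true; false; _∧_; _∨_; if_then_else_)
open import Data.List using (List; []; _∷_; length)
open import Data.List.Relation.Unary.All using (All)
open import Data.List.Relation.Unary.Linked using (Linked)
open import Data.Product using (_×_; Σ; ∃)
open import Data.Sum using (_⊎_)
open import Relation.Binary.PropositionalEquality using (_≡_)
open import Data.Nat using (_≥_)

-- Conventions
--  * A partition μ = (μ₁ ≥ μ₂ ≥ … ≥ μ_ℓ > 0) is a list of positive,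
--    weakly decreasing naturals.  |μ| = sum μ.
--  * Columns are indexed 0-based: Agda column c is the paper's column c+1.
--    Column c of the Young diagram of μ' has  height μ c  = μ_{c+1} boxes
--    (0 if c ≥ ℓ).  Rows are 1-based, row 1 at the top.
--  * The numbers 1..n are represented by Fin n (i ↦ toℕ i + 1); only their
--    order matters, and it is the order of toℕ.
--  * A container diagram is the ordered sequence (S_1, S_2, …) of disjoint
--    sets covering [n]; equivalently a function  σ : Fin n → ℕ  sending each
--    number to its column.  Every such function is a container diagram, and
--    the positions are then determined as described in the paper.

IsPartition : List ℕ → Set
IsPartition μ = All (0 <_) μ × Linked _≥_ μ

height : List ℕ → ℕ → ℕ
height []      c       = 0
height (x ∷ _) zero    = x
height (_ ∷ μ) (suc c) = height μ c

OP : ℕ → Set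
OP n = Fin n → ℕ

countFin : (n : ℕ) → (Fin n → Bool) → ℕ
countFin zero    p = 0
countFin (suc n) p = (if p Data.Fin.zero then 1 else 0) + countFin n (λ j → p (Data.Fin.suc j))

anyFin : (n : ℕ) → (Fin n → Bool) → Bool
anyFin zero    p = false
anyFin (suc n) p = p Data.Fin.zero ∨ anyFin n (λ j → p (Data.Fin.suc j))

countBelow : ℕ → (ℕ → Bool) → ℕ
countBelow zero    p = 0
countBelow (suc m) p = countBelow m p + (if p m then 1 else 0)

sumBelow : ℕ → (ℕ → ℕ) → ℕ
sumBelow zero    f = 0
sumBelow (suc m) f = sumBelow m f + f m

module _ {n : ℕ} (μ : List ℕ) (σ : OP n) where

  colSize : ℕ → ℕ
  colSize c = countFin n (λ j → σ j ≡ᵇ c)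

  rank : Fin n → ℕ
  rank i = countFin n (λ j → (σ j ≡ᵇ σ i) ∧ (toℕ j <ᵇ toℕ i))

  -- the k-th smallest (k = rank+1) element of S_c sits in row height c - rank
  -- if rank < height c; otherwise it floats above column c.

  Holds : Fin n → ℕ → ℕ → Set
  Holds j r c = σ j ≡ c × rank j < height μ c × height μ c ∸ rank j ≡ r

  Floats : Fin n → Set
  Floats j = height μ (σ j) ≤ rank j

  Empty : ℕ → ℕ → Set
  Empty r c = 1 ≤ r × r + colSize c ≤ height μ c

  largerOrEmptyᵇ : ℕ → ℕ → Fin n → Bool
  largerOrEmptyᵇ r c i =
    (r + colSize c ≤ᵇ height μ c)
    ∨ anyFin n (λ j → (σ j ≡ᵇ c) ∧ (rank j <ᵇ height μ c)
                      ∧ ((height μ c ∸ rank j) ≡ᵇ r) ∧ (toℕ i <ᵇ toℕ j))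

  code : Fin n → ℕ
  code i =
    if rank i <ᵇ height μ c
    then countBelow (length μ)
           (λ c' → (c <ᵇ c') ∧ (r ≤ᵇ height μ c') ∧ largerOrEmptyᵇ r c' i)
         + countBelow (length μ)
           (λ c' → (c' <ᵇ c) ∧ (suc r ≤ᵇ height μ c') ∧ largerOrEmptyᵇ (suc r) c' i)
    else c + countBelow (length μ)
           (λ c' → (c <ᵇ c') ∧ (1 ≤ᵇ height μ c') ∧ largerOrEmptyᵇ 1 c' i)
    where
      c = σ i
      r = height μ c ∸ rank i

  Condition1 : Set
  Condition1 = sumBelow (length μ) (λ c → height μ c ∸ colSize c) ≡ 1

  Condition2 : Set
  Condition2 =
    (∀ j j' r c c' → c < c' → Holds j r c → Holds j' r c' → toℕ j' < toℕ j)
    × (∀ r c → Empty r c → r ≡ 1 × c ≡ 0)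

  Condition3 : Set
  Condition3 =
    ∀ i → Floats i → ∀ c' → c' < σ i →
      Σ ℕ (λ r → 1 ≤ r × r ≤ height μ c' ×
        (Empty r c' ⊎ Σ (Fin n) (λ j → Holds j r c' × toℕ i < toℕ j)))

-- Keep every boxed number where it is and move each floating number i to the
-- leftmost column c ≥ 1 (the paper's column ≥ 2) holding no boxed number
-- larger than i; the column of i itself qualifies, so i only moves left.
-- By Condition 2 the empty box is the top box of the first column and all
-- other columns are full.  Hence the boxes and their contents do not change,
-- which preserves Conditions 1 and 2 and the codes of boxed numbers.  A moved
-- number still floats, since its new column is full of smaller numbers, and
-- Condition 3 holds by the leftmost choice (the first column has the empty
-- box).  The code of a floating number in column c is c plus the number of
-- columns to the right of c whose top box is empty or larger; moving one
-- column left lowers c by one and adds at most one such column.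
module Submission where

open import Defs
open import Data.Nat
  using (ℕ; zero; suc; _+_; _∸_; _≤_; _<_; _≤′_; ≤′-refl; ≤′-step; _≤ᵇ_; _<ᵇ_; _≡ᵇ_; z≤n; s≤s; _<?_)
open import Data.Nat.Properties
open import Data.Fin using (Fin; toℕ) renaming (zero to fzero; suc to fsuc)
open import Data.Fin.Properties using (toℕ-injective)
open import Data.Bool using (Bool; true; false; _∧_; _∨_; not; if_then_else_; T)
open import Data.Bool.Properties using (∧-zeroʳ; ∨-zeroʳ; ¬-not; not-injective)
open import Data.List using (List; length)
open import Data.Nat.ListAction using (sum)
open import Data.Product using (Σ; _×_; _,_; proj₁; proj₂)
open import Data.Sum using (_⊎_; inj₁; inj₂)
open import Data.Empty using (⊥; ⊥-elim)
open import Relation.Nullary using (yes; no)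
open import Relation.Binary.PropositionalEquality

bit : Bool → ℕ
bit b = if b then 1 else 0

bit≤1 : ∀ b → bit b ≤ 1
bit≤1 false = z≤n
bit≤1 true  = ≤-refl

bit-mono : ∀ {a b} → (a ≡ true → b ≡ true) → bit a ≤ bit b
bit-mono {false} _ = z≤n
bit-mono {true}  h rewrite h refl = ≤-refl

true≢false : true ≢ false
true≢false ()

true-or-false : (b : Bool) → b ≡ true ⊎ b ≡ false
true-or-false true  = inj₁ refl
true-or-false false = inj₂ refl

T⇒≡true : ∀ {b} → T b → b ≡ true
T⇒≡true {true} _ = refl

≡true⇒T : ∀ {b} → b ≡ true → T b
≡true⇒T refl = _

∧-true : ∀ {a b} → a ∧ b ≡ true → a ≡ true × b ≡ true
∧-true {true} {true} _ = refl , refl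

∧-intro : ∀ {a b} → a ≡ true → b ≡ true → a ∧ b ≡ true
∧-intro refl refl = refl

∧-cong-guarded : ∀ {x y} b → (b ≡ true → x ≡ y) → x ∧ b ≡ y ∧ b
∧-cong-guarded {x} {y} true  x≡y = cong (_∧ true) (x≡y refl)
∧-cong-guarded {x} {y} false _   = trans (∧-zeroʳ x) (sym (∧-zeroʳ y))

≡ᵇ-sound : ∀ {m n} → (m ≡ᵇ n) ≡ true → m ≡ n
≡ᵇ-sound {m} {n} e = ≡ᵇ⇒≡ m n (≡true⇒T e)

≡ᵇ-complete : ∀ {m n} → m ≡ n → (m ≡ᵇ n) ≡ true
≡ᵇ-complete {m} {n} e = T⇒≡true (≡⇒≡ᵇ m n e)

≡ᵇ-false : ∀ {m n} → m ≢ n → (m ≡ᵇ n) ≡ false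
≡ᵇ-false m≢n = ¬-not (λ e → m≢n (≡ᵇ-sound e))

<ᵇ-sound : ∀ {m n} → (m <ᵇ n) ≡ true → m < n
<ᵇ-sound {m} {n} e = <ᵇ⇒< m n (≡true⇒T e)

<ᵇ-complete : ∀ {m n} → m < n → (m <ᵇ n) ≡ true
<ᵇ-complete m<n = T⇒≡true (<⇒<ᵇ m<n)

<ᵇ-false : ∀ {m n} → n ≤ m → (m <ᵇ n) ≡ false
<ᵇ-false n≤m = ¬-not (λ e → <⇒≱ (<ᵇ-sound e) n≤m)

<ᵇ-false⇒≥ : ∀ {m n} → (m <ᵇ n) ≡ false → n ≤ m
<ᵇ-false⇒≥ e = ≮⇒≥ (λ m<n → true≢false (trans (sym (<ᵇ-complete m<n)) e))

≤ᵇ-false : ∀ {m n} → n < m → (m ≤ᵇ n) ≡ false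
≤ᵇ-false {m} {n} n<m = ¬-not (λ e → <⇒≱ n<m (≤ᵇ⇒≤ m n (≡true⇒T e)))

countFin-zero : ∀ n (p : Fin n → Bool) → (∀ j → p j ≡ false) → countFin n p ≡ 0
countFin-zero zero    p h = refl
countFin-zero (suc n) p h =
  cong₂ _+_ (cong bit (h fzero)) (countFin-zero n _ (λ j → h (fsuc j)))

countFin-cong : ∀ n (p q : Fin n → Bool) → (∀ j → p j ≡ q j) → countFin n p ≡ countFin n q
countFin-cong zero    p q h = refl
countFin-cong (suc n) p q h =
  cong₂ _+_ (cong bit (h fzero)) (countFin-cong n _ _ (λ j → h (fsuc j)))

countFin-mono : ∀ n (p q : Fin n → Bool) → (∀ j → p j ≡ true → q j ≡ true) →
  countFin n p ≤ countFin n q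
countFin-mono zero    p q h = z≤n
countFin-mono (suc n) p q h =
  +-mono-≤ (bit-mono (h fzero)) (countFin-mono n _ _ (λ j → h (fsuc j)))

countFin-< : ∀ n (p q : Fin n → Bool) → (∀ j → p j ≡ true → q j ≡ true) →
  (x : Fin n) → q x ≡ true → p x ≡ false → countFin n p < countFin n q
countFin-< (suc n) p q h fzero qx px rewrite qx | px =
  s≤s (countFin-mono n _ _ (λ j → h (fsuc j)))
countFin-< (suc n) p q h (fsuc x) qx px =
  +-mono-≤-< (bit-mono (h fzero)) (countFin-< n _ _ (λ j → h (fsuc j)) x qx px)

countFin-kth : ∀ n (q : Fin n → Bool) k → k < countFin n q →
  Σ (Fin n) λ j → q j ≡ true × countFin n (λ j' → q j' ∧ (toℕ j' <ᵇ toℕ j)) ≡ k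
countFin-kth (suc n) q k k<|q| with q fzero in q0
countFin-kth (suc n) q zero k<|q| | true =
  fzero , q0 , countFin-zero n _ (λ j → ∧-zeroʳ (q (fsuc j)))
countFin-kth (suc n) q (suc k) k<|q| | true
  with countFin-kth n (λ j → q (fsuc j)) k (≤-pred k<|q|)
... | j , qj , below = fsuc j , qj , cong suc below
countFin-kth (suc n) q k k<|q| | false
  with countFin-kth n (λ j → q (fsuc j)) k k<|q|
... | j , qj , below = fsuc j , qj , below

anyFin-intro : ∀ n (p : Fin n → Bool) j → p j ≡ true → anyFin n p ≡ true
anyFin-intro (suc n) p fzero    e = cong (_∨ anyFin n (λ j → p (fsuc j))) e
anyFin-intro (suc n) p (fsuc j) e =
  trans (cong (p fzero ∨_) (anyFin-intro n _ j e)) (∨-zeroʳ (p fzero))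

anyFin-elim : ∀ n (p : Fin n → Bool) → anyFin n p ≡ true → Σ (Fin n) λ j → p j ≡ true
anyFin-elim (suc n) p e with p fzero in p0
... | true  = fzero , p0
... | false with anyFin-elim n (λ j → p (fsuc j)) e
...   | j , pj = fsuc j , pj

anyFin-false : ∀ n (p : Fin n → Bool) → (∀ j → p j ≡ false) → anyFin n p ≡ false
anyFin-false zero    p h = refl
anyFin-false (suc n) p h = cong₂ _∨_ (h fzero) (anyFin-false n _ (λ j → h (fsuc j)))

anyFin-cong : ∀ n (p q : Fin n → Bool) → (∀ j → p j ≡ q j) → anyFin n p ≡ anyFin n q
anyFin-cong zero    p q h = refl
anyFin-cong (suc n) p q h = cong₂ _∨_ (h fzero) (anyFin-cong n _ _ (λ j → h (fsuc j)))

sumBelow-cong : ∀ m f g → (∀ c → f c ≡ g c) → sumBelow m f ≡ sumBelow m g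
sumBelow-cong zero    f g h = refl
sumBelow-cong (suc m) f g h = cong₂ _+_ (sumBelow-cong m f g h) (h m)

sumBelow≡1⇒positive : ∀ m f → sumBelow m f ≡ 1 → Σ ℕ λ c → 1 ≤ f c
sumBelow≡1⇒positive (suc m) f e with f m in fm
... | suc _ = m , subst (1 ≤_) (sym fm) (s≤s z≤n)
... | zero  = sumBelow≡1⇒positive m f (trans (sym (+-identityʳ _)) e)

countBelow-cong : ∀ m p q → (∀ c → p c ≡ q c) → countBelow m p ≡ countBelow m q
countBelow-cong zero    p q h = refl
countBelow-cong (suc m) p q h = cong₂ _+_ (countBelow-cong m p q h) (cong bit (h m))

countAbove : ℕ → (ℕ → Bool) → ℕ → ℕ
countAbove m R a = countBelow m (λ c → (a <ᵇ c) ∧ R c)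

-- The unit bit (suc a <ᵇ m) pays for column suc a, the only one counted by a but not by suc a.
countAbove-suc : ∀ m R a → countAbove m R a ≤ countAbove m R (suc a) + bit (suc a <ᵇ m)
countAbove-suc zero    R a = z≤n
countAbove-suc (suc m) R a = begin
    A + bit ((a <ᵇ m) ∧ R m)
      ≤⟨ +-monoˡ-≤ _ (countAbove-suc m R a) ⟩
    (B + bit (suc a <ᵇ m)) + bit ((a <ᵇ m) ∧ R m)
      ≡⟨ +-assoc B _ _ ⟩
    B + (bit (suc a <ᵇ m) + bit ((a <ᵇ m) ∧ R m))
      ≤⟨ +-monoʳ-≤ B (new-column-moves (suc a <ᵇ m) refl) ⟩
    B + (bit ((suc a <ᵇ m) ∧ R m) + bit (a <ᵇ m))
      ≡⟨ +-assoc B _ _ ⟨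
    (B + bit ((suc a <ᵇ m) ∧ R m)) + bit (a <ᵇ m) ∎
  where
    open ≤-Reasoning
    A B : ℕ
    A = countAbove m R a
    B = countAbove m R (suc a)
    new-column-moves : ∀ b → (suc a <ᵇ m) ≡ b →
      bit b + bit ((a <ᵇ m) ∧ R m) ≤ bit (b ∧ R m) + bit (a <ᵇ m)
    new-column-moves true e rewrite <ᵇ-complete {a} {m} (<⇒≤ (<ᵇ-sound e)) =
      ≤-reflexive (+-comm 1 (bit (R m)))
    new-column-moves false _ = bit-mono {(a <ᵇ m) ∧ R m} (λ e → proj₁ (∧-true e))

+countAbove-mono : ∀ m R {a b} → a ≤ b → a + countAbove m R a ≤ b + countAbove m R b
+countAbove-mono m R a≤b = go (≤⇒≤′ a≤b)
  where
    go : ∀ {a b} → a ≤′ b → a + countAbove m R a ≤ b + countAbove m R b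
    go ≤′-refl = ≤-refl
    go (≤′-step {b} a≤′b) = ≤-trans (go a≤′b) (begin
      b + countAbove m R b
        ≤⟨ +-monoʳ-≤ b (countAbove-suc m R b) ⟩
      b + (countAbove m R (suc b) + bit (suc b <ᵇ m))
        ≤⟨ +-monoʳ-≤ b (+-monoʳ-≤ _ (bit≤1 _)) ⟩
      b + (countAbove m R (suc b) + 1)
        ≡⟨ cong (b +_) (+-comm _ 1) ⟩
      b + suc (countAbove m R (suc b))
        ≡⟨ +-suc b _ ⟩
      suc b + countAbove m R (suc b) ∎)
      where open ≤-Reasoning

findFrom : (ℕ → Bool) → ℕ → ℕ → ℕ
findFrom P zero    c = c
findFrom P (suc k) c = if P c then c else findFrom P k (suc c)

findFrom-≥ : ∀ (P : ℕ → Bool) k c → c ≤ findFrom P k c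
findFrom-≥ P zero    c = ≤-refl
findFrom-≥ P (suc k) c with P c
... | true  = ≤-refl
... | false = ≤-trans (n≤1+n c) (findFrom-≥ P k (suc c))

findFrom-≤ : ∀ (P : ℕ → Bool) k c → findFrom P k c ≤ k + c
findFrom-≤ P zero    c = ≤-refl
findFrom-≤ P (suc k) c with P c
... | true  = m≤n+m c (suc k)
... | false = ≤-trans (findFrom-≤ P k (suc c)) (≤-reflexive (+-suc k c))

findFrom-sat : ∀ (P : ℕ → Bool) k c → P (k + c) ≡ true → P (findFrom P k c) ≡ true
findFrom-sat P zero    c e = e
findFrom-sat P (suc k) c e with P c in Pc
... | true  = Pc
... | false = findFrom-sat P k (suc c) (trans (cong P (+-suc k c)) e)

findFrom-least : ∀ (P : ℕ → Bool) k c c' → c ≤ c' → c' < findFrom P k c → P c' ≡ false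
findFrom-least P zero    c c' c≤c' c'<f = ⊥-elim (<⇒≱ c'<f c≤c')
findFrom-least P (suc k) c c' c≤c' c'<f with P c in Pc
... | true  = ⊥-elim (<⇒≱ c'<f c≤c')
... | false with m≤n⇒m<n∨m≡n c≤c'
...   | inj₁ c<c' = findFrom-least P k (suc c) c' c<c' c'<f
...   | inj₂ refl = Pc

rank<colSize : ∀ {n} μ (τ : OP n) j → rank μ τ j < colSize μ τ (τ j)
rank<colSize {n} μ τ j =
  countFin-< n _ (λ j' → τ j' ≡ᵇ τ j) (λ j' e → proj₁ (∧-true e))
    j (≡ᵇ-complete {τ j} refl)
    (trans (cong ((τ j ≡ᵇ τ j) ∧_) (<ᵇ-false {toℕ j} ≤-refl)) (∧-zeroʳ _))

rank-< : ∀ {n} μ (τ : OP n) j' j → τ j' ≡ τ j → toℕ j' < toℕ j → rank μ τ j' < rank μ τ j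
rank-< {n} μ τ j' j same j'<j =
  countFin-< n (λ x → (τ x ≡ᵇ τ j') ∧ (toℕ x <ᵇ toℕ j'))
               (λ x → (τ x ≡ᵇ τ j) ∧ (toℕ x <ᵇ toℕ j))
    (λ x e → ∧-intro (≡ᵇ-complete (trans (≡ᵇ-sound {τ x} (proj₁ (∧-true e))) same))
                     (<ᵇ-complete (<-trans (<ᵇ-sound (proj₂ (∧-true e))) j'<j)))
    j' (∧-intro (≡ᵇ-complete same) (<ᵇ-complete j'<j))
    (trans (cong ((τ j' ≡ᵇ τ j') ∧_) (<ᵇ-false {toℕ j'} ≤-refl)) (∧-zeroʳ _))

module CodeShape (μ : List ℕ) where

  boxCode : ℕ → ℕ → (ℕ → ℕ → Bool) → ℕ
  boxCode c k L =
      countBelow (length μ) (λ c' → (c <ᵇ c') ∧ (row ≤ᵇ height μ c') ∧ L row c')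
    + countBelow (length μ) (λ c' → (c' <ᵇ c) ∧ (suc row ≤ᵇ height μ c') ∧ L (suc row) c')
    where
      row : ℕ
      row = height μ c ∸ k

  floatCode : ℕ → (ℕ → ℕ → Bool) → ℕ
  floatCode c L = c + countAbove (length μ) (λ c' → (1 ≤ᵇ height μ c') ∧ L 1 c') c

  codeOf : ℕ → ℕ → (ℕ → ℕ → Bool) → ℕ
  codeOf c k L = if k <ᵇ height μ c then boxCode c k L else floatCode c L

  code≡codeOf : ∀ {n} (τ : OP n) i →
    code μ τ i ≡ codeOf (τ i) (rank μ τ i) (λ r c' → largerOrEmptyᵇ μ τ r c' i)
  code≡codeOf τ i = refl

  codeOf-boxed : ∀ c k L → k < height μ c → codeOf c k L ≡ boxCode c k L
  codeOf-boxed c k L k<h =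
    cong (λ b → if b then boxCode c k L else floatCode c L) (<ᵇ-complete k<h)

  codeOf-floating : ∀ c k L → height μ c ≤ k → codeOf c k L ≡ floatCode c L
  codeOf-floating c k L h≤k =
    cong (λ b → if b then boxCode c k L else floatCode c L) (<ᵇ-false h≤k)

  AgreeOnBoxes : (ℕ → ℕ → Bool) → (ℕ → ℕ → Bool) → Set
  AgreeOnBoxes L L' = ∀ r c' → 1 ≤ r → L r c' ≡ L' r c'

  boxCode-cong : ∀ c k L L' → k < height μ c → AgreeOnBoxes L L' → boxCode c k L ≡ boxCode c k L'
  boxCode-cong c k L L' k<h agree = cong₂ _+_
    (countBelow-cong (length μ) _ _
      (λ c' → cong (λ x → (c <ᵇ c') ∧ (row ≤ᵇ height μ c') ∧ x) (agree row c' (m<n⇒0<n∸m k<h))))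
    (countBelow-cong (length μ) _ _
      (λ c' → cong (λ x → (c' <ᵇ c) ∧ (suc row ≤ᵇ height μ c') ∧ x)
                   (agree (suc row) c' (s≤s z≤n))))
    where
      row : ℕ
      row = height μ c ∸ k

  floatCode-cong : ∀ c L L' → AgreeOnBoxes L L' → floatCode c L ≡ floatCode c L'
  floatCode-cong c L L' agree = cong (c +_) (countBelow-cong (length μ) _ _
    (λ c' → cong (λ x → (c <ᵇ c') ∧ (1 ≤ᵇ height μ c') ∧ x) (agree 1 c' ≤-refl)))

  codeOf-cong : ∀ c k L L' → AgreeOnBoxes L L' → codeOf c k L ≡ codeOf c k L'
  codeOf-cong c k L L' agree with k <? height μ c
  ... | yes k<h = trans (codeOf-boxed c k L k<h)
                    (trans (boxCode-cong c k L L' k<h agree) (sym (codeOf-boxed c k L' k<h)))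
  ... | no  k≮h = trans (codeOf-floating c k L (≮⇒≥ k≮h))
                    (trans (floatCode-cong c L L' agree) (sym (codeOf-floating c k L' (≮⇒≥ k≮h))))

module PushFloatingLeft (n : ℕ) (μ : List ℕ) (σ : OP n)
                        (cond1 : Condition1 μ σ) (cond2 : Condition2 μ σ) where

  open CodeShape μ

  h : ℕ → ℕ
  h = height μ

  rk : Fin n → ℕ
  rk = rank μ σ

  boxedᵇ : Fin n → Bool
  boxedᵇ j = rk j <ᵇ h (σ j)

  largerBoxedᵇ : Fin n → ℕ → Fin n → Bool
  largerBoxedᵇ i c j = (σ j ≡ᵇ c) ∧ (rk j <ᵇ h c) ∧ (toℕ i <ᵇ toℕ j)

  largerBoxed-sound : ∀ i c j → largerBoxedᵇ i c j ≡ true → σ j ≡ c × rk j < h c × toℕ i < toℕ j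
  largerBoxed-sound i c j e =
    let (σj≡c , rest) = ∧-true e
        (rkj<h , i<j) = ∧-true rest
    in ≡ᵇ-sound σj≡c , <ᵇ-sound rkj<h , <ᵇ-sound i<j

  largerBoxed-complete : ∀ i c j → σ j ≡ c → rk j < h c → toℕ i < toℕ j → largerBoxedᵇ i c j ≡ true
  largerBoxed-complete i c j σj≡c rkj<h i<j =
    ∧-intro (≡ᵇ-complete σj≡c) (∧-intro (<ᵇ-complete rkj<h) (<ᵇ-complete i<j))

  freeForᵇ : Fin n → ℕ → Bool
  freeForᵇ i c = not (anyFin n (largerBoxedᵇ i c))

  target : Fin n → ℕ
  target i = findFrom (freeForᵇ i) (σ i ∸ 1) 1

  γ : OP n
  γ i = if boxedᵇ i then σ i else target i

  γ-boxed : ∀ j → boxedᵇ j ≡ true → γ j ≡ σ j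
  γ-boxed j e = cong (λ b → if b then σ j else target j) e

  γ-floating : ∀ j → boxedᵇ j ≡ false → γ j ≡ target j
  γ-floating j e = cong (λ b → if b then σ j else target j) e

  boxed⇒rank< : ∀ j c → σ j ≡ c → boxedᵇ j ≡ true → rk j < h c
  boxed⇒rank< j c σj≡c bj = subst (λ x → rk j < h x) σj≡c (<ᵇ-sound bj)

  rank<⇒boxed : ∀ j c → σ j ≡ c → rk j < h c → boxedᵇ j ≡ true
  rank<⇒boxed j c σj≡c rkj<h = <ᵇ-complete (subst (λ x → rk j < h x) (sym σj≡c) rkj<h)

  column0-hasEmpty : 1 + colSize μ σ 0 ≤ h 0
  column0-hasEmpty with sumBelow≡1⇒positive (length μ) _ cond1
  ... | c , 1≤h∸col = subst (λ x → 1 + colSize μ σ x ≤ h x) c≡0 col<h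
    where
      col<h : colSize μ σ c < h c
      col<h = m∸n≢0⇒n<m (n>0⇒n≢0 1≤h∸col)
      c≡0 : c ≡ 0
      c≡0 = proj₂ (proj₂ cond2 1 c (≤-refl , col<h))

  column-full : ∀ c → 1 ≤ c → h c ≤ colSize μ σ c
  column-full c 1≤c =
    ≮⇒≥ (λ col<h → <⇒≱ 1≤c (≤-reflexive (proj₂ (proj₂ cond2 1 c (≤-refl , col<h)))))

  floating⇒column-pos : ∀ j → boxedᵇ j ≡ false → 1 ≤ σ j
  floating⇒column-pos j bj = n≢0⇒n>0 (λ σj≡0 → <⇒≱ (boxed σj≡0) (<ᵇ-false⇒≥ bj))
    where
      boxed : σ j ≡ 0 → rk j < h (σ j)
      boxed σj≡0 = <-trans (rank<colSize μ σ j)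
        (subst (λ x → 1 + colSize μ σ x ≤ h x) (sym σj≡0) column0-hasEmpty)

  boxed-below : ∀ j j' → boxedᵇ j ≡ true → σ j' ≡ σ j → toℕ j' < toℕ j → boxedᵇ j' ≡ true
  boxed-below j j' bj same j'<j =
    rank<⇒boxed j' (σ j) same (<-trans (rank-< μ σ j' j same j'<j) (boxed⇒rank< j (σ j) refl bj))

  full-column-entry : ∀ c k → 1 ≤ c → h c ≡ suc k →
    Σ (Fin n) λ j → σ j ≡ c × rk j ≡ k × boxedᵇ j ≡ true
  full-column-entry c k 1≤c h≡ with countFin-kth n (λ j → σ j ≡ᵇ c) k
                                      (subst (_≤ colSize μ σ c) h≡ (column-full c 1≤c))
  ... | j , inColumn , below =
    j , σj≡c , rkj≡k , rank<⇒boxed j c σj≡c (subst₂ _<_ (sym rkj≡k) (sym h≡) ≤-refl)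
    where
      σj≡c : σ j ≡ c
      σj≡c = ≡ᵇ-sound inColumn
      rkj≡k : rk j ≡ k
      rkj≡k = trans (countFin-cong n _ _
        (λ j' → cong (λ x → (σ j' ≡ᵇ x) ∧ (toℕ j' <ᵇ toℕ j)) σj≡c)) below

  target-pos : ∀ i → 1 ≤ target i
  target-pos i = findFrom-≥ (freeForᵇ i) (σ i ∸ 1) 1

  freeFor-own-column : ∀ i → boxedᵇ i ≡ false → freeForᵇ i (σ i) ≡ true
  freeFor-own-column i bi = cong not (anyFin-false n _ (λ j → ¬-not (λ e →
    let (σj≡σi , rkj<h , i<j) = largerBoxed-sound i (σ i) j e
    in <⇒≱ (<-trans (rank-< μ σ i j (sym σj≡σi) i<j) rkj<h) (<ᵇ-false⇒≥ bi))))

  target-≤ : ∀ i → boxedᵇ i ≡ false → target i ≤ σ i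
  target-≤ i bi = ≤-trans (findFrom-≤ (freeForᵇ i) (σ i ∸ 1) 1)
    (≤-reflexive (m∸n+n≡m (floating⇒column-pos i bi)))

  target-free : ∀ i → boxedᵇ i ≡ false → freeForᵇ i (target i) ≡ true
  target-free i bi = findFrom-sat (freeForᵇ i) (σ i ∸ 1) 1
    (trans (cong (freeForᵇ i) (m∸n+n≡m (floating⇒column-pos i bi))) (freeFor-own-column i bi))

  target-least : ∀ i c → 1 ≤ c → c < target i → freeForᵇ i c ≡ false
  target-least i c = findFrom-least (freeForᵇ i) (σ i ∸ 1) 1 c

  free⇒noLargerBoxed : ∀ i c j → freeForᵇ i c ≡ true → σ j ≡ c → boxedᵇ j ≡ true → toℕ j ≤ toℕ i
  free⇒noLargerBoxed i c j free σj≡c bj = ≮⇒≥ larger⇒notFree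
    where
      larger⇒notFree : toℕ i < toℕ j → ⊥
      larger⇒notFree i<j = true≢false (trans (sym free) (cong not (anyFin-intro n _ j
        (largerBoxed-complete i c j σj≡c (boxed⇒rank< j c σj≡c bj) i<j))))

  target-entries-smaller : ∀ i j → boxedᵇ i ≡ false → σ j ≡ target i → boxedᵇ j ≡ true →
    toℕ j < toℕ i
  target-entries-smaller i j bi σj≡t bj =
    ≤∧≢⇒< (free⇒noLargerBoxed i (target i) j (target-free i bi) σj≡t bj) j≢i
    where
      j≢i : toℕ j ≢ toℕ i
      j≢i j≡i = true≢false (trans (sym (subst (λ x → boxedᵇ x ≡ true) (toℕ-injective j≡i) bj)) bi)

  rank-γ-boxed : ∀ j → boxedᵇ j ≡ true → rank μ γ j ≡ rk j
  rank-γ-boxed j bj = countFin-cong n _ _ (λ j' → ∧-cong-guarded (toℕ j' <ᵇ toℕ j) (same-column j'))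
    where
      same-column : ∀ j' → (toℕ j' <ᵇ toℕ j) ≡ true → (γ j' ≡ᵇ γ j) ≡ (σ j' ≡ᵇ σ j)
      same-column j' e with true-or-false (boxedᵇ j')
      ... | inj₁ bj' = cong₂ _≡ᵇ_ (γ-boxed j' bj') (γ-boxed j bj)
      ... | inj₂ bj' = trans (≡ᵇ-false γ-differ) (sym (≡ᵇ-false σ-differ))
        where
          γ-differ : γ j' ≢ γ j
          γ-differ same = <⇒≱ (<ᵇ-sound e) (free⇒noLargerBoxed j' (target j') j (target-free j' bj')
            (trans (sym (γ-boxed j bj)) (trans (sym same) (γ-floating j' bj'))) bj)
          σ-differ : σ j' ≢ σ j
          σ-differ same = true≢false (trans (sym (boxed-below j j' bj same (<ᵇ-sound e))) bj')

  -- A moved number lies above the whole (full) target column, whose entries are smaller.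
  target-full-below : ∀ i → boxedᵇ i ≡ false → h (target i) ≤ rank μ γ i
  target-full-below i bi with h (target i) in h≡
  ... | zero  = z≤n
  ... | suc k with full-column-entry (target i) k (target-pos i) h≡
  ... | j0 , σj0≡t , rkj0≡k , bj0 = subst (λ x → suc x ≤ rank μ γ i) below≡k below<rank
    where
      below : Fin n → Bool
      below j' = (σ j' ≡ᵇ target i) ∧ (toℕ j' <ᵇ toℕ j0)
      below≡k : countFin n below ≡ k
      below≡k = trans (countFin-cong n _ _
        (λ j' → cong (λ x → (σ j' ≡ᵇ x) ∧ (toℕ j' <ᵇ toℕ j0)) (sym σj0≡t))) rkj0≡k
      counted : ∀ j' → boxedᵇ j' ≡ true → σ j' ≡ target i →
        ((γ j' ≡ᵇ γ i) ∧ (toℕ j' <ᵇ toℕ i)) ≡ true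
      counted j' bj' σj'≡t =
        ∧-intro (≡ᵇ-complete (trans (γ-boxed j' bj') (trans σj'≡t (sym (γ-floating i bi)))))
                (<ᵇ-complete (target-entries-smaller i j' bi σj'≡t bj'))
      below⇒counted : ∀ j' → below j' ≡ true → ((γ j' ≡ᵇ γ i) ∧ (toℕ j' <ᵇ toℕ i)) ≡ true
      below⇒counted j' e =
        let (inColumn , j'<j0) = ∧-true e
            σj'≡t = ≡ᵇ-sound inColumn
        in counted j' (boxed-below j0 j' bj0 (trans σj'≡t (sym σj0≡t)) (<ᵇ-sound j'<j0)) σj'≡t
      below<rank : countFin n below < rank μ γ i
      below<rank = countFin-< n below _ below⇒counted j0 (counted j0 bj0 σj0≡t)
        (trans (cong ((σ j0 ≡ᵇ target i) ∧_) (<ᵇ-false {toℕ j0} ≤-refl)) (∧-zeroʳ _))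

  γ-keeps-floating : ∀ i → boxedᵇ i ≡ false → h (γ i) ≤ rank μ γ i
  γ-keeps-floating i bi =
    subst (λ x → h x ≤ rank μ γ i) (sym (γ-floating i bi)) (target-full-below i bi)

  boxed-of-γ : ∀ j → rank μ γ j < h (γ j) → boxedᵇ j ≡ true
  boxed-of-γ j lt with true-or-false (boxedᵇ j)
  ... | inj₁ bj = bj
  ... | inj₂ bj = ⊥-elim (<⇒≱ lt (γ-keeps-floating j bj))

  colSize-γ-0 : colSize μ γ 0 ≡ colSize μ σ 0
  colSize-γ-0 = countFin-cong n _ _ in-column0
    where
      in-column0 : ∀ j → (γ j ≡ᵇ 0) ≡ (σ j ≡ᵇ 0)
      in-column0 j with true-or-false (boxedᵇ j)
      ... | inj₁ bj = cong (_≡ᵇ 0) (γ-boxed j bj)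
      ... | inj₂ bj = trans
        (≡ᵇ-false (λ γj≡0 → <⇒≱ (target-pos j) (≤-reflexive (trans (sym (γ-floating j bj)) γj≡0))))
        (sym (≡ᵇ-false (λ σj≡0 → <⇒≱ (floating⇒column-pos j bj) (≤-reflexive σj≡0))))

  γ-column-full : ∀ c → 1 ≤ c → h c ≤ colSize μ γ c
  γ-column-full c 1≤c with h c in h≡
  ... | zero  = z≤n
  ... | suc k with full-column-entry c k 1≤c h≡
  ... | j , σj≡c , rkj≡k , bj =
    subst₂ (λ a b → suc a ≤ colSize μ γ b) (trans (rank-γ-boxed j bj) rkj≡k)
           (trans (γ-boxed j bj) σj≡c) (rank<colSize μ γ j)

  Holds-γ⇒Holds-σ : ∀ j r c → Holds μ γ j r c → Holds μ σ j r c
  Holds-γ⇒Holds-σ j r c (γj≡c , lt , row) =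
    trans (sym (γ-boxed j bj)) γj≡c ,
    subst (_< h c) rank≡ lt ,
    subst (λ x → h c ∸ x ≡ r) rank≡ row
    where
      bj : boxedᵇ j ≡ true
      bj = boxed-of-γ j (subst (λ x → rank μ γ j < h x) (sym γj≡c) lt)
      rank≡ : rank μ γ j ≡ rk j
      rank≡ = rank-γ-boxed j bj

  Holds-σ⇒Holds-γ : ∀ j r c → Holds μ σ j r c → Holds μ γ j r c
  Holds-σ⇒Holds-γ j r c (σj≡c , lt , row) =
    trans (γ-boxed j bj) σj≡c ,
    subst (_< h c) (sym rank≡) lt ,
    subst (λ x → h c ∸ x ≡ r) (sym rank≡) row
    where
      bj : boxedᵇ j ≡ true
      bj = rank<⇒boxed j c σj≡c lt
      rank≡ : rank μ γ j ≡ rk j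
      rank≡ = rank-γ-boxed j bj

  floating-notInBox : ∀ (τ : OP n) j c {b} → h (τ j) ≤ rank μ τ j →
    ((τ j ≡ᵇ c) ∧ (rank μ τ j <ᵇ h c) ∧ b) ≡ false
  floating-notInBox τ j c h≤rank = ¬-not (λ e →
    let (τj≡c , rest) = ∧-true e
    in <⇒≱ (<ᵇ-sound (proj₁ (∧-true rest)))
           (subst (λ x → h x ≤ rank μ τ j) (≡ᵇ-sound τj≡c) h≤rank))

  largerOrEmptyAt : OP n → Fin n → ℕ → ℕ → Bool
  largerOrEmptyAt τ i r c = largerOrEmptyᵇ μ τ r c i

  largerOrEmpty-γ≈σ : ∀ i → AgreeOnBoxes (largerOrEmptyAt γ i) (largerOrEmptyAt σ i)
  largerOrEmpty-γ≈σ i r c 1≤r = cong₂ _∨_ (emptyTest c) (anyFin-cong n _ _ entryTest)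
    where
      notEmpty : ∀ {c' x} → h c' ≤ x → (r + x ≤ᵇ h c') ≡ false
      notEmpty {x = x} h≤x = ≤ᵇ-false (≤-trans (s≤s h≤x) (+-monoˡ-≤ x 1≤r))
      emptyTest : ∀ c' → (r + colSize μ γ c' ≤ᵇ h c') ≡ (r + colSize μ σ c' ≤ᵇ h c')
      emptyTest zero     = cong (λ x → r + x ≤ᵇ h 0) colSize-γ-0
      emptyTest (suc c') = trans (notEmpty (γ-column-full (suc c') (s≤s z≤n)))
                                 (sym (notEmpty (column-full (suc c') (s≤s z≤n))))
      entryᵇ : OP n → Fin n → Bool
      entryᵇ τ j = (τ j ≡ᵇ c) ∧ (rank μ τ j <ᵇ h c) ∧ ((h c ∸ rank μ τ j) ≡ᵇ r) ∧ (toℕ i <ᵇ toℕ j)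
      entryTest : ∀ j → entryᵇ γ j ≡ entryᵇ σ j
      entryTest j with true-or-false (boxedᵇ j)
      ... | inj₁ bj = cong₂ (λ a b → (a ≡ᵇ c) ∧ (b <ᵇ h c) ∧ ((h c ∸ b) ≡ᵇ r) ∧ (toℕ i <ᵇ toℕ j))
                            (γ-boxed j bj) (rank-γ-boxed j bj)
      ... | inj₂ bj = trans (floating-notInBox γ j c (γ-keeps-floating j bj))
                            (sym (floating-notInBox σ j c (<ᵇ-false⇒≥ bj)))

  condition1 : Condition1 μ γ
  condition1 = trans (sumBelow-cong (length μ) _ _ sameDeficit) cond1
    where
      sameDeficit : ∀ c → h c ∸ colSize μ γ c ≡ h c ∸ colSize μ σ c
      sameDeficit zero    = cong (h 0 ∸_) colSize-γ-0
      sameDeficit (suc c) = trans (m≤n⇒m∸n≡0 (γ-column-full (suc c) (s≤s z≤n)))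
                                  (sym (m≤n⇒m∸n≡0 (column-full (suc c) (s≤s z≤n))))

  condition2 : Condition2 μ γ
  condition2 = rowsDecrease , emptyBox
    where
      rowsDecrease : ∀ j j' r c c' → c < c' →
        Holds μ γ j r c → Holds μ γ j' r c' → toℕ j' < toℕ j
      rowsDecrease j j' r c c' c<c' H H' =
        proj₁ cond2 j j' r c c' c<c' (Holds-γ⇒Holds-σ j r c H) (Holds-γ⇒Holds-σ j' r c' H')
      emptyBox : ∀ r c → Empty μ γ r c → r ≡ 1 × c ≡ 0
      emptyBox r zero    (1≤r , E) =
        proj₂ cond2 r 0 (1≤r , subst (λ x → r + x ≤ h 0) colSize-γ-0 E)
      emptyBox r (suc c) (1≤r , E) =
        ⊥-elim (<⇒≱ (≤-trans (+-monoˡ-≤ _ 1≤r) E) (γ-column-full (suc c) (s≤s z≤n)))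

  condition3 : Condition3 μ γ
  condition3 i floats c c<γi with true-or-false (boxedᵇ i)
  ... | inj₁ bi = ⊥-elim (<⇒≱ (subst₂ _<_ (sym (rank-γ-boxed i bi)) (cong h (sym (γ-boxed i bi)))
                                        (<ᵇ-sound bi)) floats)
  ... | inj₂ bi = witness c (subst (c <_) (γ-floating i bi) c<γi)
    where
      witness : ∀ c → c < target i → Σ ℕ (λ r → 1 ≤ r × r ≤ h c ×
                  (Empty μ γ r c ⊎ Σ (Fin n) (λ j → Holds μ γ j r c × toℕ i < toℕ j)))
      witness zero _ = 1 , ≤-refl , ≤-trans (m≤m+n 1 _) column0-hasEmpty ,
                       inj₁ (≤-refl , subst (λ x → 1 + x ≤ h 0) (sym colSize-γ-0) column0-hasEmpty)
      witness (suc c) c<t with anyFin-elim n _ (not-injective (target-least i (suc c) (s≤s z≤n) c<t))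
      ... | j , e = let (σj≡c , rkj<h , i<j) = largerBoxed-sound i (suc c) j e in
        h (suc c) ∸ rk j , m<n⇒0<n∸m rkj<h , m∸n≤m (h (suc c)) (rk j) ,
        inj₂ (j , Holds-σ⇒Holds-γ j _ (suc c) (σj≡c , rkj<h , refl) , i<j)

  code-γ-boxed : ∀ i → boxedᵇ i ≡ true → code μ γ i ≡ code μ σ i
  code-γ-boxed i bi = begin
    code μ γ i
      ≡⟨ code≡codeOf γ i ⟩
    codeOf (γ i) (rank μ γ i) (largerOrEmptyAt γ i)
      ≡⟨ cong₂ (λ c k → codeOf c k (largerOrEmptyAt γ i)) (γ-boxed i bi) (rank-γ-boxed i bi) ⟩
    codeOf (σ i) (rk i) (largerOrEmptyAt γ i)
      ≡⟨ codeOf-cong (σ i) (rk i) (largerOrEmptyAt γ i) (largerOrEmptyAt σ i)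
           (largerOrEmpty-γ≈σ i) ⟩
    codeOf (σ i) (rk i) (largerOrEmptyAt σ i)
      ≡⟨ code≡codeOf σ i ⟨
    code μ σ i ∎
    where open ≡-Reasoning

  code-γ-floating : ∀ i → boxedᵇ i ≡ false → code μ γ i ≤ code μ σ i
  code-γ-floating i bi = begin
    code μ γ i
      ≡⟨ code≡codeOf γ i ⟩
    codeOf (γ i) (rank μ γ i) (largerOrEmptyAt γ i)
      ≡⟨ codeOf-cong (γ i) (rank μ γ i) (largerOrEmptyAt γ i) (largerOrEmptyAt σ i)
           (largerOrEmpty-γ≈σ i) ⟩
    codeOf (γ i) (rank μ γ i) (largerOrEmptyAt σ i)
      ≡⟨ codeOf-floating (γ i) (rank μ γ i) (largerOrEmptyAt σ i) (γ-keeps-floating i bi) ⟩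
    floatCode (γ i) (largerOrEmptyAt σ i)
      ≡⟨ cong (λ c → floatCode c (largerOrEmptyAt σ i)) (γ-floating i bi) ⟩
    floatCode (target i) (largerOrEmptyAt σ i)
      ≤⟨ +countAbove-mono (length μ) _ (target-≤ i bi) ⟩
    floatCode (σ i) (largerOrEmptyAt σ i)
      ≡⟨ codeOf-floating (σ i) (rk i) (largerOrEmptyAt σ i) (<ᵇ-false⇒≥ bi) ⟨
    codeOf (σ i) (rk i) (largerOrEmptyAt σ i)
      ≡⟨ code≡codeOf σ i ⟨
    code μ σ i ∎
    where open ≤-Reasoning

  code-≤ : ∀ i → code μ γ i ≤ code μ σ i
  code-≤ i with true-or-false (boxedᵇ i)
  ... | inj₁ bi = ≤-reflexive (code-γ-boxed i bi)
  ... | inj₂ bi = code-γ-floating i bi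

lemmaL : (n : ℕ) → 1 ≤ n → (μ : List ℕ) → IsPartition μ →
    1 ≤ sum μ → sum μ ≤ suc n →
    (σ : OP n) → Condition1 μ σ → Condition2 μ σ →
    Σ (OP n) (λ γ → Condition1 μ γ × Condition2 μ γ × Condition3 μ γ ×
    ((i : Fin n) → code μ γ i ≤ code μ σ i))
lemmaL n _ μ _ _ _ σ cond1 cond2 = γ , condition1 , condition2 , condition3 , code-≤
  where open PushFloatingLeft n μ σ cond1 cond2
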